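{- Let $p$ be a prime and $d$ a positive divisor of $p-1$. Let $n$ be a fixed positive integer and $H$ a positive integer with $H<p$. Then the number $I$ of integers $h\in\{1,2,\ldots,H\}$ which are $d$-th power residues modulo $p$ satisfies $$I\lesssim\frac{H}{d^{1/n}}+\frac{p^{1/n}}{d^{1/n}}.$$
   Context: An integer $h$ is a $d$-th power residue modulo $p$ if $h\equiv z^d\pmod p$ for some $z\in\mathbb{F}_p^*$. The notation $A\lesssim B$ means $|A|\leqslant Bp^{o(1)}$ as $p\to\infty$ (the $o(1)$ may depend on $n$, but is uniform in $d$ and $H$). -}

module Defs where

open import Data.Nat using (ℕ; zero; suc; _+_; _*_; _^_; _<_; _≤_; NonZero)
open import Data.Nat.Properties using (_≟_; _<?_)
open import Data.Nat.DivMod using (_%_)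
open import Data.Fin using (Fin; toℕ)
open import Data.Fin.Properties using (any?)
open import Data.Product using (Σ; _×_)
open import Data.List using (List; length; filter; map; upTo)
open import Relation.Binary.PropositionalEquality using (_≡_)
open import Relation.Nullary using (Dec)
open import Relation.Nullary.Decidable using (_×-dec_)

PowerResidue : (p d h : ℕ) → .{{NonZero p}} → Set
PowerResidue p d h = Σ (Fin p) λ z → (0 < toℕ z) × ((toℕ z ^ d) % p ≡ h % p)

powerResidue? : (p d h : ℕ) → .{{_ : NonZero p}} → Dec (PowerResidue p d h)
powerResidue? p d h = any? λ z → (0 <? toℕ z) ×-dec ((toℕ z ^ d) % p ≟ h % p)

countResidues : (p d H : ℕ) → .{{_ : NonZero p}} → ℕ
countResidues p d H = length (filter (λ h → powerResidue? p d h) (map suc (upTo H)))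

{-# OPTIONS --safe #-}
module Submission where

-- The d-th power residues form a multiplicatively closed set not containing 0. Grouping the
-- pairs (a, b) of residues a ≤ H, b ≤ Y by their product c ≤ HY, each of which has at most
-- τ(c) factorisations, gives I(H)·I(Y) ≤ T·I(HY) for T = max τ; iterating, I(H)^n ≤ T^(n−1)·I(H^n).
-- By Fermat every residue is a root of x^((p−1)/d) − 1, so by Lagrange each period of length p
-- contains at most (p−1)/d of them, whence I(X)·d ≤ X + p. With R = 2(n−1)m the divisor bound
-- τ(c)^R ≤ (R^R)^(2^R)·c gives (T^((n−1)m)·2^m)² ≤ P₀·H^n ≤ p^(2n) once p ≥ P₀ = (R^R)^(2^R)·4^m,
-- and raising I^n·d ≤ T^(n−1)·(H^n + p) to the m-th power yields the claim.

open import Defs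
open import Data.Nat using (ℕ; suc; _+_; _*_; _^_; _<_; _≤_; _∸_; NonZero)
open import Data.Nat.Divisibility using (_∣_)
open import Data.Nat.Primality using (Prime)
open import Data.Product using (Σ)

open import Data.Nat.Base
open import Data.Nat.Properties
open import Data.Product using (_×_; _,_; ∃; ∃₂)
open import Data.Sum using (inj₁; inj₂; [_,_]′)
open import Data.Nat.Divisibility
open import Data.Nat.DivMod
open import Data.Nat.GCD using (gcd; gcd[m,n]∣m; gcd[m,n]∣n; gcd[m,n]≢0)
open import Data.Nat.Coprimality using (Coprime; coprime-/gcd; coprime-divisor)
open import Data.Nat.Primality
  using (_Rough_; 2-rough; rough⇒≤; ∤⇒rough-suc; rough∧∣⇒rough; rough∧∣⇒prime;
         euclidsLemma; ¬prime[1]; prime⇒nonZero; prime⇒irreducible)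
open import Data.Nat.Combinatorics using (_C_; nC1≡n; nCn≡1; k>n⇒nCk≡0; nCk+nC[k+1]≡[n+1]C[k+1])
open import Data.Fin using (Fin; toℕ; fromℕ<)
open import Data.Fin.Properties using (toℕ<n; toℕ-fromℕ<)
open import Data.List using (List; []; _∷_; length; replicate; filter; map; upTo; applyUpTo)
open import Data.List.Properties using (length-replicate; map-applyUpTo)
open import Data.Nat.Induction using (<-rec)
open import Data.Nat.Solver using (module +-*-Solver)
open import Function.Base using (_∘_; id; it)
open import Relation.Nullary using (Dec; yes; no; ¬_; contradiction)
open import Relation.Binary.PropositionalEquality
import Algebra.Properties.CommutativeSemigroup as CommSemigroupProperties

module +-CS = CommSemigroupProperties +-commutativeSemigroup
module *-CS = CommSemigroupProperties *-commutativeSemigroup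

∑< : ℕ → (ℕ → ℕ) → ℕ
∑< zero    f = 0
∑< (suc n) f = f 0 + ∑< n (f ∘ suc)

infix 10 ∑<
syntax ∑< n (λ i → e) = ∑[ i < n ] e

∑-cong : ∀ n {f g : ℕ → ℕ} → (∀ i → i < n → f i ≡ g i) → ∑< n f ≡ ∑< n g
∑-cong zero    f≡g = refl
∑-cong (suc n) f≡g = cong₂ _+_ (f≡g 0 z<s) (∑-cong n (λ i i<n → f≡g (suc i) (s<s i<n)))

∑-mono-≤ : ∀ n {f g : ℕ → ℕ} → (∀ i → i < n → f i ≤ g i) → ∑< n f ≤ ∑< n g
∑-mono-≤ zero    f≤g = z≤n
∑-mono-≤ (suc n) f≤g = +-mono-≤ (f≤g 0 z<s) (∑-mono-≤ n (λ i i<n → f≤g (suc i) (s<s i<n)))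

∑≤n*c : ∀ n {c} {f : ℕ → ℕ} → (∀ i → i < n → f i ≤ c) → ∑< n f ≤ n * c
∑≤n*c zero    f≤c = z≤n
∑≤n*c (suc n) f≤c = +-mono-≤ (f≤c 0 z<s) (∑≤n*c n (λ i i<n → f≤c (suc i) (s<s i<n)))

∑-zero : ∀ n {f : ℕ → ℕ} → (∀ i → i < n → f i ≡ 0) → ∑< n f ≡ 0
∑-zero n f≡0 = n≤0⇒n≡0 (≤-trans (∑≤n*c n (λ i i<n → ≤-reflexive (f≡0 i i<n))) (≤-reflexive (*-zeroʳ n)))

∑-distrib-+ : ∀ n (f g : ℕ → ℕ) → ∑[ i < n ] (f i + g i) ≡ ∑< n f + ∑< n g
∑-distrib-+ zero    f g = refl
∑-distrib-+ (suc n) f g = begin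
  f 0 + g 0 + ∑[ i < n ] (f (suc i) + g (suc i)) ≡⟨ cong (f 0 + g 0 +_) (∑-distrib-+ n (f ∘ suc) (g ∘ suc)) ⟩
  f 0 + g 0 + (∑< n (f ∘ suc) + ∑< n (g ∘ suc))  ≡⟨ +-CS.interchange (f 0) (g 0) _ _ ⟩
  f 0 + ∑< n (f ∘ suc) + (g 0 + ∑< n (g ∘ suc))  ∎
  where open ≡-Reasoning

∑-*ˡ : ∀ n c (f : ℕ → ℕ) → ∑[ i < n ] (c * f i) ≡ c * ∑< n f
∑-*ˡ zero    c f = sym (*-zeroʳ c)
∑-*ˡ (suc n) c f = trans (cong (c * f 0 +_) (∑-*ˡ n c (f ∘ suc))) (sym (*-distribˡ-+ c (f 0) _))

∑-*ʳ : ∀ n c (f : ℕ → ℕ) → ∑[ i < n ] (f i * c) ≡ ∑< n f * c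
∑-*ʳ n c f = trans (∑-cong n (λ i _ → *-comm (f i) c)) (trans (∑-*ˡ n c f) (*-comm c _))

∑-comm : ∀ m n (f : ℕ → ℕ → ℕ) → ∑[ i < m ] ∑[ j < n ] f i j ≡ ∑[ j < n ] ∑[ i < m ] f i j
∑-comm zero    n f = sym (∑-zero n (λ _ _ → refl))
∑-comm (suc m) n f = trans (cong (∑< n (f 0) +_) (∑-comm m n (f ∘ suc)))
                           (sym (∑-distrib-+ n (f 0) (λ j → ∑[ i < m ] f (suc i) j)))

∑-+ : ∀ m n (f : ℕ → ℕ) → ∑< (m + n) f ≡ ∑< m f + ∑[ i < n ] f (m + i)
∑-+ zero    n f = refl
∑-+ (suc m) n f = trans (cong (f 0 +_) (∑-+ m n (f ∘ suc))) (sym (+-assoc (f 0) _ _))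

∑-suc : ∀ n (f : ℕ → ℕ) → ∑< (suc n) f ≡ ∑< n f + f n
∑-suc zero    f = +-identityʳ (f 0)
∑-suc (suc n) f = trans (cong (f 0 +_) (∑-suc n (f ∘ suc))) (sym (+-assoc (f 0) _ _))

term≤∑ : ∀ n (f : ℕ → ℕ) {j} → j < n → f j ≤ ∑< n f
term≤∑ (suc n) f {zero}  _         = m≤m+n (f 0) _
term≤∑ (suc n) f {suc j} (s<s j<n) = ≤-trans (term≤∑ n (f ∘ suc) j<n) (m≤n+m _ (f 0))

∑>0⇒term>0 : ∀ n (f : ℕ → ℕ) → 0 < ∑< n f → ∃ λ i → i < n × 0 < f i
∑>0⇒term>0 (suc n) f ∑>0 with f 0 in eq
... | suc _ = 0 , z<s , subst (0 <_) (sym eq) z<s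
... | zero with ∑>0⇒term>0 n (f ∘ suc) ∑>0
...   | i , i<n , fi>0 = suc i , s<s i<n , fi>0

∑-mono-length : ∀ {m n} (f : ℕ → ℕ) → m ≤ n → ∑< m f ≤ ∑< n f
∑-mono-length {m} f m≤n with m≤n⇒∃[o]m+o≡n m≤n
... | k , refl = ≤-trans (m≤m+n _ _) (≤-reflexive (sym (∑-+ m k f)))

∑-truncate : ∀ m n (f : ℕ → ℕ) → (∀ i → n ≤ i → f i ≡ 0) → ∑< m f ≤ ∑< n f
∑-truncate m n f vanish with ≤-total m n
... | inj₁ m≤n = ∑-mono-length f m≤n
... | inj₂ n≤m with m≤n⇒∃[o]m+o≡n n≤m
...   | k , refl = ≤-reflexive (begin
  ∑< (n + k) f                    ≡⟨ ∑-+ n k f ⟩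
  ∑< n f + ∑[ i < k ] f (n + i)   ≡⟨ cong (∑< n f +_) (∑-zero k (λ i _ → vanish (n + i) (m≤m+n n i))) ⟩
  ∑< n f + 0                      ≡⟨ +-identityʳ _ ⟩
  ∑< n f                          ∎)
  where open ≡-Reasoning

∑-periodic : ∀ q p (f : ℕ → ℕ) → (∀ k → f (p + k) ≡ f k) → ∑< (q * p) f ≡ q * ∑< p f
∑-periodic zero    p f periodic = refl
∑-periodic (suc q) p f periodic = begin
  ∑< (p + q * p) f                          ≡⟨ ∑-+ p (q * p) f ⟩
  ∑< p f + ∑[ i < q * p ] f (p + i)         ≡⟨ cong (∑< p f +_) (∑-periodic q p (λ i → f (p + i)) (periodic ∘ (p +_))) ⟩
  ∑< p f + q * ∑[ i < p ] f (p + i)         ≡⟨ cong (λ s → ∑< p f + q * s) (∑-cong p (λ i _ → periodic i)) ⟩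
  ∑< p f + q * ∑< p f                       ∎
  where open ≡-Reasoning

∑-∣ : ∀ n {d} (f : ℕ → ℕ) → (∀ i → i < n → d ∣ f i) → d ∣ ∑< n f
∑-∣ zero    f d∣f = _ ∣0
∑-∣ (suc n) f d∣f = ∣m∣n⇒∣m+n (d∣f 0 z<s) (∑-∣ n (f ∘ suc) (λ i i<n → d∣f (suc i) (s<s i<n)))

∑*d≤+period : ∀ p .{{_ : NonZero p}} X d (f : ℕ → ℕ) → (∀ k → f (p + k) ≡ f k) → ∑< p f * d ≤ p →
              ∑< (suc X) f * d ≤ X + p
∑*d≤+period p X d f periodic ∑f*d≤p = begin
  ∑< (suc X) f * d          ≤⟨ *-monoˡ-≤ d (∑-mono-length f 1+X≤[1+q]*p) ⟩
  ∑< (suc q * p) f * d      ≡⟨ cong (_* d) (∑-periodic (suc q) p f periodic) ⟩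
  suc q * ∑< p f * d        ≡⟨ *-assoc (suc q) (∑< p f) d ⟩
  suc q * (∑< p f * d)      ≤⟨ *-monoʳ-≤ (suc q) ∑f*d≤p ⟩
  p + q * p                 ≤⟨ +-monoʳ-≤ p (m/n*n≤m X p) ⟩
  p + X                     ≡⟨ +-comm p X ⟩
  X + p                     ∎
  where
  open ≤-Reasoning
  q = X / p
  1+X≤[1+q]*p : suc X ≤ suc q * p
  1+X≤[1+q]*p = subst (λ x → suc x ≤ suc q * p) (sym (m≡m%n+[m/n]*n X p)) (+-monoˡ-≤ (q * p) (m%n<n X p))

𝟙 : {A : Set} → Dec A → ℕ
𝟙 (yes _) = 1
𝟙 (no _)  = 0

𝟙-yes : {A : Set} (a? : Dec A) → A → 𝟙 a? ≡ 1
𝟙-yes (yes _) a = refl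
𝟙-yes (no ¬a) a = contradiction a ¬a

𝟙-no : {A : Set} (a? : Dec A) → ¬ A → 𝟙 a? ≡ 0
𝟙-no (yes a) ¬a = contradiction a ¬a
𝟙-no (no _)  ¬a = refl

𝟙>0⇒ : {A : Set} (a? : Dec A) → 0 < 𝟙 a? → A
𝟙>0⇒ (yes a) _ = a

𝟙-mono : {A B : Set} (a? : Dec A) (b? : Dec B) → (A → B) → 𝟙 a? ≤ 𝟙 b?
𝟙-mono (yes a) b?     A⇒B = ≤-reflexive (sym (𝟙-yes b? (A⇒B a)))
𝟙-mono (no _)  b?     A⇒B = z≤n

𝟙-cong : {A B : Set} (a? : Dec A) (b? : Dec B) → (A → B) → (B → A) → 𝟙 a? ≡ 𝟙 b?
𝟙-cong a? b? A⇒B B⇒A = ≤-antisym (𝟙-mono a? b? A⇒B) (𝟙-mono b? a? B⇒A)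

𝟙*𝟙≤𝟙 : {A B C : Set} (a? : Dec A) (b? : Dec B) (c? : Dec C) → (A → B → C) → 𝟙 a? * 𝟙 b? ≤ 𝟙 c?
𝟙*𝟙≤𝟙 (yes a) (yes b) c? A⇒B⇒C = ≤-reflexive (sym (𝟙-yes c? (A⇒B⇒C a b)))
𝟙*𝟙≤𝟙 (yes _) (no _)  c? A⇒B⇒C = z≤n
𝟙*𝟙≤𝟙 (no _)  b?      c? A⇒B⇒C = z≤n

∑𝟙≤1 : ∀ n {P : ℕ → Set} (P? : ∀ i → Dec (P i)) → (∀ {i j} → P i → P j → i ≡ j) →
       ∑[ i < n ] 𝟙 (P? i) ≤ 1
∑𝟙≤1 zero    P? unique = z≤n
∑𝟙≤1 (suc n) P? unique with P? 0
... | yes P0 = ≤-reflexive (cong suc (∑-zero n (λ i _ → 𝟙-no (P? (suc i)) (λ Pi → 0≢1+n (unique P0 Pi)))))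
... | no _   = ∑𝟙≤1 n (P? ∘ suc) (λ Pi Pj → suc-injective (unique Pi Pj))

∑𝟙[≡]≤1 : ∀ n v → ∑[ i < n ] 𝟙 (i ≟ v) ≤ 1
∑𝟙[≡]≤1 n v = ∑𝟙≤1 n (_≟ v) (λ i≡v j≡v → trans i≡v (sym j≡v))

∑𝟙[≡]≡1 : ∀ {n v} → v < n → ∑[ i < n ] 𝟙 (i ≟ v) ≡ 1
∑𝟙[≡]≡1 {n} {v} v<n = ≤-antisym (∑𝟙[≡]≤1 n v)
  (≤-trans (≤-reflexive (sym (𝟙-yes (v ≟ v) refl))) (term≤∑ n (λ i → 𝟙 (i ≟ v)) v<n))

∑-fibres : ∀ A B N (F : ℕ → ℕ → ℕ) → (∀ {a b} → a < A → b < B → a * b < N) →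
  ∑[ a < A ] ∑[ b < B ] F a b ≡ ∑[ c < N ] ∑[ a < A ] ∑[ b < B ] (F a b * 𝟙 (a * b ≟ c))
∑-fibres A B N F ab<N = begin
  ∑[ a < A ] ∑[ b < B ] F a b
    ≡⟨ ∑-cong A (λ a a<A → ∑-cong B (λ b b<B → fibre a<A b<B)) ⟩
  ∑[ a < A ] ∑[ b < B ] ∑[ c < N ] (F a b * 𝟙 (a * b ≟ c))
    ≡⟨ ∑-cong A (λ a _ → ∑-comm B N (λ b c → F a b * 𝟙 (a * b ≟ c))) ⟩
  ∑[ a < A ] ∑[ c < N ] ∑[ b < B ] (F a b * 𝟙 (a * b ≟ c))
    ≡⟨ ∑-comm A N (λ a c → ∑[ b < B ] (F a b * 𝟙 (a * b ≟ c))) ⟩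
  ∑[ c < N ] ∑[ a < A ] ∑[ b < B ] (F a b * 𝟙 (a * b ≟ c))
    ∎
  where
  open ≡-Reasoning
  fibre : ∀ {a b} → a < A → b < B → F a b ≡ ∑[ c < N ] (F a b * 𝟙 (a * b ≟ c))
  fibre {a} {b} a<A b<B = begin
    F a b                                   ≡⟨ sym (*-identityʳ (F a b)) ⟩
    F a b * 1                               ≡⟨ cong (F a b *_) (sym (∑𝟙[≡]≡1 (ab<N a<A b<B))) ⟩
    F a b * ∑[ c < N ] 𝟙 (c ≟ a * b)        ≡⟨ sym (∑-*ˡ N (F a b) (λ c → 𝟙 (c ≟ a * b))) ⟩
    ∑[ c < N ] (F a b * 𝟙 (c ≟ a * b))      ≡⟨ ∑-cong N (λ c _ → cong (F a b *_) (𝟙-cong (c ≟ a * b) (a * b ≟ c) sym sym)) ⟩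
    ∑[ c < N ] (F a b * 𝟙 (a * b ≟ c))      ∎

count : {P : ℕ → Set} → (∀ k → Dec (P k)) → ℕ → ℕ
count P? Z = ∑[ k < suc Z ] 𝟙 (P? k)

length-filter≡count : {P : ℕ → Set} (P? : ∀ k → Dec (P k)) → ¬ P 0 → ∀ H →
                      length (filter P? (map suc (upTo H))) ≡ count P? H
length-filter≡count P? ¬P[0] H = begin
  length (filter P? (map suc (upTo H)))     ≡⟨ cong (length ∘ filter P?) (map-applyUpTo id suc H) ⟩
  length (filter P? (applyUpTo suc H))      ≡⟨ length-filter-applyUpTo suc H ⟩
  ∑[ k < H ] 𝟙 (P? (suc k))                 ≡⟨ cong (_+ ∑[ k < H ] 𝟙 (P? (suc k))) (𝟙-no (P? 0) ¬P[0]) ⟨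
  count P? H                                ∎
  where
  open ≡-Reasoning
  length-filter-applyUpTo : ∀ f n → length (filter P? (applyUpTo f n)) ≡ ∑[ k < n ] 𝟙 (P? (f k))
  length-filter-applyUpTo f zero    = refl
  length-filter-applyUpTo f (suc n) with P? (f 0)
  ... | yes _ = cong suc (length-filter-applyUpTo (f ∘ suc) n)
  ... | no  _ = length-filter-applyUpTo (f ∘ suc) n

^-distribʳ-* : ∀ m n k → (m * n) ^ k ≡ m ^ k * n ^ k
^-distribʳ-* m n zero    = refl
^-distribʳ-* m n (suc k) = trans (cong (m * n *_) (^-distribʳ-* m n k)) (*-CS.interchange m n (m ^ k) (n ^ k))

module _ {p : ℕ} .{{_ : NonZero p}} where

  %-cong-+ : ∀ x x′ y y′ → x % p ≡ x′ % p → y % p ≡ y′ % p → (x + y) % p ≡ (x′ + y′) % p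
  %-cong-+ x x′ y y′ x≡x′ y≡y′ = begin
    (x + y) % p                ≡⟨ %-distribˡ-+ x y p ⟩
    (x % p + y % p) % p        ≡⟨ cong₂ (λ a b → (a + b) % p) x≡x′ y≡y′ ⟩
    (x′ % p + y′ % p) % p      ≡⟨ %-distribˡ-+ x′ y′ p ⟨
    (x′ + y′) % p              ∎
    where open ≡-Reasoning

  %-cong-* : ∀ x x′ y y′ → x % p ≡ x′ % p → y % p ≡ y′ % p → (x * y) % p ≡ (x′ * y′) % p
  %-cong-* x x′ y y′ x≡x′ y≡y′ = begin
    (x * y) % p                ≡⟨ %-distribˡ-* x y p ⟩
    (x % p * (y % p)) % p      ≡⟨ cong₂ (λ a b → (a * b) % p) x≡x′ y≡y′ ⟩
    (x′ % p * (y′ % p)) % p    ≡⟨ %-distribˡ-* x′ y′ p ⟨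
    (x′ * y′) % p              ∎
    where open ≡-Reasoning

  %-cong-^ : ∀ x y k → x % p ≡ y % p → (x ^ k) % p ≡ (y ^ k) % p
  %-cong-^ x y zero    x≡y = refl
  %-cong-^ x y (suc k) x≡y = %-cong-* x y (x ^ k) (y ^ k) x≡y (%-cong-^ x y k x≡y)

  %≡⇒∣∸ : ∀ x y → x % p ≡ y % p → p ∣ x ∸ y
  %≡⇒∣∸ x y x≡y = divides (x / p ∸ y / p) (begin
    x ∸ y                                    ≡⟨ cong₂ _∸_ (m≡m%n+[m/n]*n x p) (m≡m%n+[m/n]*n y p) ⟩
    x % p + x / p * p ∸ (y % p + y / p * p)  ≡⟨ cong (λ r → x % p + x / p * p ∸ (r + y / p * p)) x≡y ⟨
    x % p + x / p * p ∸ (x % p + y / p * p)  ≡⟨ [m+n]∸[m+o]≡n∸o (x % p) _ _ ⟩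
    x / p * p ∸ y / p * p                    ≡⟨ *-distribʳ-∸ p (x / p) (y / p) ⟨
    (x / p ∸ y / p) * p                      ∎)
    where open ≡-Reasoning

  ∣∸⇒%≡ : ∀ {x y} → x ≤ y → p ∣ y ∸ x → x % p ≡ y % p
  ∣∸⇒%≡ {x} {y} x≤y p∣y∸x = begin
    x % p              ≡⟨ %-remove-+ʳ x p∣y∸x ⟨
    (x + (y ∸ x)) % p  ≡⟨ cong (_% p) (m+[n∸m]≡n x≤y) ⟩
    y % p              ∎
    where open ≡-Reasoning

[1+k]*[1+n]C[1+k]≡[1+n]*nCk : ∀ n k → suc k * (suc n C suc k) ≡ suc n * (n C k)
[1+k]*[1+n]C[1+k]≡[1+n]*nCk n       zero    = trans (+-identityʳ _) (trans (nC1≡n (suc n)) (sym (*-identityʳ (suc n))))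
[1+k]*[1+n]C[1+k]≡[1+n]*nCk zero    (suc k) = trans (cong ((2 + k) *_) (k>n⇒nCk≡0 {1} (s<s (z<s {k})))) (*-zeroʳ (2 + k))
[1+k]*[1+n]C[1+k]≡[1+n]*nCk (suc n) (suc k) = begin
  (2 + k) * ((2 + n) C (2 + k))
    ≡⟨ cong ((2 + k) *_) (nCk+nC[k+1]≡[n+1]C[k+1] (suc n) (suc k)) ⟨
  (2 + k) * (X + Y)
    ≡⟨ *-distribˡ-+ (2 + k) X Y ⟩
  X + (1 + k) * X + (2 + k) * Y
    ≡⟨ cong₂ (λ a b → X + a + b) ([1+k]*[1+n]C[1+k]≡[1+n]*nCk n k) ([1+k]*[1+n]C[1+k]≡[1+n]*nCk n (suc k)) ⟩
  X + (1 + n) * (n C k) + (1 + n) * (n C suc k)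
    ≡⟨ +-assoc X _ _ ⟩
  X + ((1 + n) * (n C k) + (1 + n) * (n C suc k))
    ≡⟨ cong (X +_) (*-distribˡ-+ (1 + n) (n C k) (n C suc k)) ⟨
  X + (1 + n) * (n C k + n C suc k)
    ≡⟨ cong (λ c → X + (1 + n) * c) (nCk+nC[k+1]≡[n+1]C[k+1] n k) ⟩
  (2 + n) * X
    ∎
  where
  open ≡-Reasoning
  X = suc n C suc k
  Y = suc n C (2 + k)

binomial-theorem : ∀ a n → (a + 1) ^ n ≡ ∑[ k < suc n ] ((n C k) * a ^ k)
binomial-theorem a zero    = refl
binomial-theorem a (suc n) = sym (begin
  1 + ∑[ k < suc n ] ((suc n C suc k) * (a * a ^ k))      ≡⟨ cong (1 +_) (∑-cong (suc n) (λ k _ → pascal-term k)) ⟩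
  1 + ∑[ k < suc n ] (a * f k + f (suc k))                ≡⟨ cong (1 +_) (∑-distrib-+ (suc n) (λ k → a * f k) (f ∘ suc)) ⟩
  1 + (∑[ k < suc n ] (a * f k) + ∑< (suc n) (f ∘ suc))   ≡⟨ cong (λ s → 1 + (s + ∑< (suc n) (f ∘ suc))) (∑-*ˡ (suc n) a f) ⟩
  1 + (a * X + ∑< (suc n) (f ∘ suc))                      ≡⟨ +-CS.x∙yz≈y∙xz 1 (a * X) _ ⟩
  a * X + ∑< (suc (suc n)) f                              ≡⟨ cong (a * X +_) shift ⟩
  a * X + 1 * X                                           ≡⟨ *-distribʳ-+ X a 1 ⟨
  (a + 1) * X                                             ≡⟨ cong ((a + 1) *_) (binomial-theorem a n) ⟨
  (a + 1) * (a + 1) ^ n                                   ∎)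
  where
  open ≡-Reasoning
  f : ℕ → ℕ
  f k = (n C k) * a ^ k
  X = ∑< (suc n) f
  pascal-term : ∀ k → (suc n C suc k) * (a * a ^ k) ≡ a * f k + f (suc k)
  pascal-term k = begin
    (suc n C suc k) * (a * a ^ k)                        ≡⟨ cong (_* (a * a ^ k)) (nCk+nC[k+1]≡[n+1]C[k+1] n k) ⟨
    (n C k + n C suc k) * (a * a ^ k)                    ≡⟨ *-distribʳ-+ (a * a ^ k) (n C k) _ ⟩
    (n C k) * (a * a ^ k) + (n C suc k) * (a * a ^ k)    ≡⟨ cong (_+ f (suc k)) (*-CS.x∙yz≈y∙xz (n C k) a (a ^ k)) ⟩
    a * f k + f (suc k)                                  ∎
  shift : ∑< (suc (suc n)) f ≡ 1 * X
  shift = begin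
    ∑< (suc (suc n)) f     ≡⟨ ∑-suc (suc n) f ⟩
    X + f (suc n)          ≡⟨ cong (λ c → X + c * a ^ suc n) (k>n⇒nCk≡0 (n<1+n n)) ⟩
    X + 0                  ≡⟨ +-identityʳ X ⟩
    X                      ≡⟨ *-identityˡ X ⟨
    1 * X                  ∎

evalMonic : List ℕ → ℕ → ℕ
evalMonic []       x = 1
evalMonic (a ∷ as) x = a + x * evalMonic as x

evalMonic-replicate-0 : ∀ k x → evalMonic (replicate k 0) x ≡ x ^ k
evalMonic-replicate-0 zero    x = refl
evalMonic-replicate-0 (suc k) x = cong (x *_) (evalMonic-replicate-0 k x)

deflate : ℕ → List ℕ → List ℕ
deflate r []       = []
deflate r (b ∷ bs) = evalMonic (b ∷ bs) r ∷ deflate r bs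

length-deflate : ∀ r as → length (deflate r as) ≡ length as
length-deflate r []       = refl
length-deflate r (b ∷ bs) = cong suc (length-deflate r bs)

-- f(x) − f(r) = (x − r)·q(x) for f = a ∷ g and q = deflate r g, with both sides moved so that
-- no subtraction occurs.
deflate-spec : ∀ a g x r →
  evalMonic (a ∷ g) x + r * evalMonic (deflate r g) x ≡ evalMonic (a ∷ g) r + x * evalMonic (deflate r g) x
deflate-spec a []       x r = +-CS.xy∙z≈xz∙y a (x * 1) (r * 1)
deflate-spec a (b ∷ bs) x r = begin
  a + x * G x + r * (G r + x * Q)
    ≡⟨ solve 6 (λ a x Gx r Gr Q → a :+ x :* Gx :+ r :* (Gr :+ x :* Q) := a :+ r :* Gr :+ x :* (Gx :+ r :* Q))
               refl a x (G x) r (G r) Q ⟩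
  a + r * G r + x * (G x + r * Q)
    ≡⟨ cong (λ y → a + r * G r + x * y) (deflate-spec b bs x r) ⟩
  a + r * G r + x * (G r + x * Q)
    ∎
  where
  open ≡-Reasoning
  open +-*-Solver
  G = evalMonic (b ∷ bs)
  Q = evalMonic (deflate r bs) x

module _ {n : ℕ} (p-prime : Prime (suc n)) where

  private
    p = suc n

  p∣pC[1+k] : ∀ {k} → suc k < p → p ∣ p C suc k
  p∣pC[1+k] {k} 1+k<p with euclidsLemma (suc k) (p C suc k) p-prime (divides (n C k) absorption)
    where
    absorption : suc k * (p C suc k) ≡ (n C k) * p
    absorption = trans ([1+k]*[1+n]C[1+k]≡[1+n]*nCk n k) (*-comm p (n C k))
  ... | inj₁ p∣1+k = contradiction (∣⇒≤ p∣1+k) (<⇒≱ 1+k<p)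
  ... | inj₂ p∣C   = p∣C

  freshman's-dream : ∀ a → (a + 1) ^ p % p ≡ (a ^ p + 1) % p
  freshman's-dream a = begin
    (a + 1) ^ p % p                   ≡⟨ cong (_% p) (binomial-theorem a p) ⟩
    (1 + ∑< p (g ∘ suc)) % p          ≡⟨ cong (λ s → (1 + s) % p) (∑-suc n (g ∘ suc)) ⟩
    (1 + (middle + g p)) % p          ≡⟨ cong (λ c → (1 + (middle + c)) % p) g[p]≡a^p ⟩
    (1 + (middle + a ^ p)) % p        ≡⟨ cong (_% p) (+-CS.x∙yz≈zx∙y 1 middle (a ^ p)) ⟩
    (a ^ p + 1 + middle) % p          ≡⟨ %-remove-+ʳ (a ^ p + 1) p∣middle ⟩
    (a ^ p + 1) % p                   ∎
    where
    open ≡-Reasoning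
    g : ℕ → ℕ
    g k = (p C k) * a ^ k
    middle = ∑< n (g ∘ suc)
    p∣middle : p ∣ middle
    p∣middle = ∑-∣ n (g ∘ suc) (λ k k<n → ∣m⇒∣m*n (a ^ suc k) (p∣pC[1+k] (s<s k<n)))
    g[p]≡a^p : g p ≡ a ^ p
    g[p]≡a^p = trans (cong (_* a ^ p) (nCn≡1 p)) (*-identityˡ (a ^ p))

  fermat's-little-theorem : ∀ a → a ^ p % p ≡ a % p
  fermat's-little-theorem zero    = refl
  fermat's-little-theorem (suc a) = begin
    suc a ^ p % p     ≡⟨ cong (λ x → x ^ p % p) (+-comm 1 a) ⟩
    (a + 1) ^ p % p   ≡⟨ freshman's-dream a ⟩
    (a ^ p + 1) % p   ≡⟨ %-cong-+ (a ^ p) a 1 1 (fermat's-little-theorem a) refl ⟩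
    (a + 1) % p       ≡⟨ cong (_% p) (+-comm a 1) ⟩
    suc a % p         ∎
    where open ≡-Reasoning

  %-cancelˡ-* : ∀ {z x y} → ¬ p ∣ z → (z * x) % p ≡ (z * y) % p → x % p ≡ y % p
  %-cancelˡ-* {z} {x} {y} p∤z zx≡zy =
    [ (λ x≤y → cancel x≤y zx≡zy) , (λ y≤x → sym (cancel y≤x (sym zx≡zy))) ]′ (≤-total x y)
    where
    cancel : ∀ {x y} → x ≤ y → (z * x) % p ≡ (z * y) % p → x % p ≡ y % p
    cancel {x} {y} x≤y zx≡zy with euclidsLemma z (y ∸ x) p-prime p∣z[y∸x]
      where
      p∣z[y∸x] : p ∣ z * (y ∸ x)
      p∣z[y∸x] = subst (p ∣_) (sym (*-distribˡ-∸ z y x)) (%≡⇒∣∸ (z * y) (z * x) (sym zx≡zy))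
    ... | inj₁ p∣z   = contradiction p∣z p∤z
    ... | inj₂ p∣y∸x = ∣∸⇒%≡ x≤y p∣y∸x

  fermat : ∀ {z} → ¬ p ∣ z → z ^ n % p ≡ 1 % p
  fermat {z} p∤z = %-cancelˡ-* p∤z (trans (fermat's-little-theorem z) (cong (_% p) (sym (*-identityʳ z))))

  deflate-root : ∀ {a g x r} → x < p → r < p → x ≢ r →
    p ∣ evalMonic (a ∷ g) x → p ∣ evalMonic (a ∷ g) r → p ∣ evalMonic (deflate r g) x
  deflate-root {a} {g} {x} {r} x<p r<p x≢r p∣f[x] p∣f[r] with p ∣? evalMonic (deflate r g) x
  ... | yes p∣q[x] = p∣q[x]
  ... | no  p∤q[x] = contradiction x≡r x≢r
    where
    q[x] = evalMonic (deflate r g) x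
    q[x]*r≡q[x]*x : (q[x] * r) % p ≡ (q[x] * x) % p
    q[x]*r≡q[x]*x = begin
      (q[x] * r) % p                           ≡⟨ cong (_% p) (*-comm q[x] r) ⟩
      (r * q[x]) % p                           ≡⟨ %-remove-+ˡ (r * q[x]) p∣f[x] ⟨
      (evalMonic (a ∷ g) x + r * q[x]) % p     ≡⟨ cong (_% p) (deflate-spec a g x r) ⟩
      (evalMonic (a ∷ g) r + x * q[x]) % p     ≡⟨ %-remove-+ˡ (x * q[x]) p∣f[r] ⟩
      (x * q[x]) % p                           ≡⟨ cong (_% p) (*-comm x q[x]) ⟩
      (q[x] * x) % p                           ∎
      where open ≡-Reasoning
    x≡r : x ≡ r
    x≡r = trans (sym (m<n⇒m%n≡m x<p)) (trans (sym (%-cancelˡ-* p∤q[x] q[x]*r≡q[x]*x)) (m<n⇒m%n≡m r<p))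

  roots≤degree : ∀ as → ∑[ x < p ] 𝟙 (p ∣? evalMonic as x) ≤ length as
  roots≤degree as = go (length as) as refl
    where
    go : ∀ k as → length as ≡ k → ∑[ x < p ] 𝟙 (p ∣? evalMonic as x) ≤ k
    go k       []       _   = ≤-trans (≤-reflexive (∑-zero p (λ x _ → 𝟙-no (p ∣? 1) p∤1))) z≤n
      where
      p∤1 : ¬ p ∣ 1
      p∤1 p∣1 = ¬prime[1] (subst Prime (∣1⇒≡1 p∣1) p-prime)
    go (suc k) (a ∷ g) len with 0 <? ∑[ x < p ] 𝟙 (p ∣? evalMonic (a ∷ g) x)
    ... | no  no-root = ≤-trans (≮⇒≥ no-root) z≤n
    ... | yes has-root with ∑>0⇒term>0 p (λ x → 𝟙 (p ∣? evalMonic (a ∷ g) x)) has-root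
    ...   | r , r<p , r-root = begin
      ∑[ x < p ] 𝟙 (p ∣? evalMonic (a ∷ g) x)
        ≤⟨ ∑-mono-≤ p split ⟩
      ∑[ x < p ] (𝟙 (x ≟ r) + 𝟙 (p ∣? evalMonic (deflate r g) x))
        ≡⟨ ∑-distrib-+ p (λ x → 𝟙 (x ≟ r)) (λ x → 𝟙 (p ∣? evalMonic (deflate r g) x)) ⟩
      ∑[ x < p ] 𝟙 (x ≟ r) + ∑[ x < p ] 𝟙 (p ∣? evalMonic (deflate r g) x)
        ≤⟨ +-mono-≤ (∑𝟙[≡]≤1 p r) (go k (deflate r g) (trans (length-deflate r g) (suc-injective len))) ⟩
      suc k
        ∎
      where
      open ≤-Reasoning
      split : ∀ x → x < p → 𝟙 (p ∣? evalMonic (a ∷ g) x) ≤ 𝟙 (x ≟ r) + 𝟙 (p ∣? evalMonic (deflate r g) x)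
      split x x<p with p ∣? evalMonic (a ∷ g) x | x ≟ r
      ... | no  _       | _       = z≤n
      ... | yes _       | yes _   = s≤s z≤n
      ... | yes p∣f[x]  | no  x≢r = ≤-reflexive (sym (𝟙-yes (p ∣? evalMonic (deflate r g) x)
                                      (deflate-root {a} {g} x<p r<p x≢r p∣f[x] (𝟙>0⇒ (p ∣? evalMonic (a ∷ g) r) r-root))))

p∣m^k⇒p∣m : ∀ {p m} → Prime p → ∀ k → p ∣ m ^ k → p ∣ m
p∣m^k⇒p∣m p-prime zero    p∣1 = contradiction (subst Prime (∣1⇒≡1 p∣1) p-prime) ¬prime[1]
p∣m^k⇒p∣m {m = m} p-prime (suc k) p∣m^[1+k] with euclidsLemma m (m ^ k) p-prime p∣m^[1+k]
... | inj₁ p∣m   = p∣m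
... | inj₂ p∣m^k = p∣m^k⇒p∣m p-prime k p∣m^k

module _ {n : ℕ} (p-prime : Prime (suc n)) (d : ℕ) where

  private
    p = suc n

    p∤unit : ∀ (z : Fin p) → 0 < toℕ z → ¬ p ∣ toℕ z
    p∤unit z 0<z p∣z = <⇒≱ (toℕ<n z) (∣⇒≤ {{>-nonZero 0<z}} p∣z)

  ¬PowerResidue[0] : ¬ PowerResidue p d 0
  ¬PowerResidue[0] (z , 0<z , z^d≡0) = p∤unit z 0<z (p∣m^k⇒p∣m p-prime d (m%n≡0⇒n∣m _ p z^d≡0))

  PowerResidue-* : ∀ {a b} → PowerResidue p d a → PowerResidue p d b → PowerResidue p d (a * b)
  PowerResidue-* {a} {b} (z₁ , 0<z₁ , z₁^d≡a) (z₂ , 0<z₂ , z₂^d≡b) = fromℕ< (m%n<n z p) , 0<z%p , z%p^d≡ab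
    where
    z = toℕ z₁ * toℕ z₂
    0<z%p : 0 < toℕ (fromℕ< (m%n<n z p))
    0<z%p = subst (0 <_) (sym (toℕ-fromℕ< (m%n<n z p))) (n≢0⇒n>0 z%p≢0)
      where
      z%p≢0 : z % p ≢ 0
      z%p≢0 z%p≡0 with euclidsLemma (toℕ z₁) (toℕ z₂) p-prime (m%n≡0⇒n∣m z p z%p≡0)
      ... | inj₁ p∣z₁ = p∤unit z₁ 0<z₁ p∣z₁
      ... | inj₂ p∣z₂ = p∤unit z₂ 0<z₂ p∣z₂
    z%p^d≡ab : toℕ (fromℕ< (m%n<n z p)) ^ d % p ≡ (a * b) % p
    z%p^d≡ab = begin
      toℕ (fromℕ< (m%n<n z p)) ^ d % p      ≡⟨ cong (λ x → x ^ d % p) (toℕ-fromℕ< (m%n<n z p)) ⟩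
      (z % p) ^ d % p                       ≡⟨ %-cong-^ (z % p) z d (m%n%n≡m%n z p) ⟩
      z ^ d % p                             ≡⟨ cong (_% p) (^-distribʳ-* (toℕ z₁) (toℕ z₂) d) ⟩
      (toℕ z₁ ^ d * toℕ z₂ ^ d) % p          ≡⟨ %-cong-* (toℕ z₁ ^ d) a (toℕ z₂ ^ d) b z₁^d≡a z₂^d≡b ⟩
      (a * b) % p                           ∎
      where open ≡-Reasoning

  𝟙PowerResidue-periodic : ∀ k → 𝟙 (powerResidue? p d (p + k)) ≡ 𝟙 (powerResidue? p d k)
  𝟙PowerResidue-periodic k = 𝟙-cong (powerResidue? p d (p + k)) (powerResidue? p d k)
    (λ (z , 0<z , z^d≡p+k) → z , 0<z , trans z^d≡p+k p+k≡k)
    (λ (z , 0<z , z^d≡k)   → z , 0<z , trans z^d≡k (sym p+k≡k))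
    where
    p+k≡k : (p + k) % p ≡ k % p
    p+k≡k = trans (cong (_% p) (+-comm p k)) ([m+n]%n≡m%n k p)

  PowerResidue⇒root : ∀ {e h} → n ≡ e * d → PowerResidue p d h → p ∣ n + h ^ e
  PowerResidue⇒root {e} {h} n≡e*d (z , 0<z , z^d≡h) = m%n≡0⇒n∣m (n + h ^ e) p (begin
    (n + h ^ e) % p         ≡⟨ %-cong-+ n n (h ^ e) 1 refl h^e≡1 ⟩
    (n + 1) % p             ≡⟨ cong (_% p) (+-comm n 1) ⟩
    p % p                   ≡⟨ n%n≡0 p ⟩
    0                       ∎)
    where
    open ≡-Reasoning
    t = toℕ z
    h^e≡1 : h ^ e % p ≡ 1 % p
    h^e≡1 = begin
      h ^ e % p             ≡⟨ %-cong-^ h (t ^ d) e (sym z^d≡h) ⟩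
      (t ^ d) ^ e % p       ≡⟨ cong (_% p) (^-*-assoc t d e) ⟩
      t ^ (d * e) % p       ≡⟨ cong (λ k → t ^ k % p) (trans (*-comm d e) (sym n≡e*d)) ⟩
      t ^ n % p             ≡⟨ fermat p-prime (p∤unit z 0<z) ⟩
      1 % p                 ∎

  residues-per-period : ∀ {e} → n ≡ e * d → ∑[ h < p ] 𝟙 (powerResidue? p d h) ≤ e
  residues-per-period {zero}  n≡0 = contradiction (subst (Prime ∘ suc) n≡0 p-prime) ¬prime[1]
  residues-per-period {suc e} n≡e*d = begin
    ∑[ h < p ] 𝟙 (powerResidue? p d h)                        ≤⟨ ∑-mono-≤ p (λ h _ → 𝟙-mono (powerResidue? p d h) (p ∣? _) (root h)) ⟩
    ∑[ h < p ] 𝟙 (p ∣? evalMonic (n ∷ replicate e 0) h)       ≤⟨ roots≤degree p-prime (n ∷ replicate e 0) ⟩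
    suc (length (replicate e 0))                             ≡⟨ cong suc (length-replicate e) ⟩
    suc e                                                    ∎
    where
    open ≤-Reasoning
    -- n ∷ replicate e 0 is the monic polynomial x^(1+e) + (p − 1), i.e. x^(1+e) − 1 mod p.
    root : ∀ h → PowerResidue p d h → p ∣ evalMonic (n ∷ replicate e 0) h
    root h = subst (p ∣_) (cong (λ x → n + h * x) (sym (evalMonic-replicate-0 e h))) ∘ PowerResidue⇒root {suc e} {h} n≡e*d

  count-residues : ∀ {e} → n ≡ e * d → ∀ X → count (λ h → powerResidue? p d h) X * d ≤ X + p
  count-residues {e} n≡e*d X = ∑*d≤+period p X d (λ h → 𝟙 (powerResidue? p d h)) 𝟙PowerResidue-periodic (begin
    ∑[ h < p ] 𝟙 (powerResidue? p d h) * d    ≤⟨ *-monoˡ-≤ d (residues-per-period {e} n≡e*d) ⟩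
    e * d                                    ≡⟨ n≡e*d ⟨
    n                                        ≤⟨ n≤1+n n ⟩
    p                                        ∎)
    where open ≤-Reasoning

τ : ℕ → ℕ
τ c = ∑[ a < suc c ] 𝟙 (a ∣? c)

∑∑𝟙[a*b≡c]≤τ : ∀ A B c .{{_ : NonZero c}} → ∑[ a < A ] ∑[ b < B ] 𝟙 (a * b ≟ c) ≤ τ c
∑∑𝟙[a*b≡c]≤τ A B c = begin
  ∑[ a < A ] ∑[ b < B ] 𝟙 (a * b ≟ c)   ≤⟨ ∑-mono-≤ A (λ a _ → at-most-one-cofactor a) ⟩
  ∑[ a < A ] 𝟙 (a ∣? c)                 ≤⟨ ∑-truncate A (suc c) (λ a → 𝟙 (a ∣? c)) (λ a c<a → 𝟙-no (a ∣? c) (>⇒∤ c<a)) ⟩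
  τ c                                   ∎
  where
  open ≤-Reasoning
  at-most-one-cofactor : ∀ a → ∑[ b < B ] 𝟙 (a * b ≟ c) ≤ 𝟙 (a ∣? c)
  at-most-one-cofactor a with a ∣? c
  ... | no  a∤c = ≤-reflexive (∑-zero B (λ b _ → 𝟙-no (a * b ≟ c) (λ ab≡c → a∤c (divides b (trans (sym ab≡c) (*-comm a b))))))
  ... | yes _   = ∑𝟙≤1 B (λ b → a * b ≟ c) cancel
    where
    cancel : ∀ {b b′} → a * b ≡ c → a * b′ ≡ c → b ≡ b′
    cancel {b} {b′} ab≡c ab′≡c = *-cancelˡ-≡ b b′ a {{m*n≢0⇒m≢0 a {{subst NonZero (sym ab≡c) it}}}} (trans ab≡c (sym ab′≡c))

∣m*n⇒∣m*∣n : ∀ m n {d} .{{_ : NonZero m}} → d ∣ m * n → ∃₂ λ d₁ d₂ → d₁ ∣ m × d₂ ∣ n × d ≡ d₁ * d₂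
∣m*n⇒∣m*∣n m n {d} d∣mn = g , d / g , gcd[m,n]∣n d m , d/g∣n , sym (m*[n/m]≡n (gcd[m,n]∣m d m))
  where
  g = gcd d m
  instance
    g≢0 : NonZero g
    g≢0 = ≢-nonZero (gcd[m,n]≢0 d m (inj₂ (≢-nonZero⁻¹ m)))
  g*[d/g]∣g*[[m/g]*n] : g * (d / g) ∣ g * ((m / g) * n)
  g*[d/g]∣g*[[m/g]*n] = subst₂ _∣_ (sym (m*[n/m]≡n (gcd[m,n]∣m d m)))
    (trans (cong (_* n) (sym (m*[n/m]≡n (gcd[m,n]∣n d m)))) (*-assoc g (m / g) n)) d∣mn
  d/g∣n : d / g ∣ n
  d/g∣n = coprime-divisor (coprime-/gcd d m) (*-cancelˡ-∣ g g*[d/g]∣g*[[m/g]*n])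

τ-submultiplicative : ∀ m n .{{_ : NonZero m}} .{{_ : NonZero n}} → τ (m * n) ≤ τ m * τ n
τ-submultiplicative m n = begin
  ∑[ c < suc (m * n) ] 𝟙 (c ∣? m * n)
    ≤⟨ ∑-mono-≤ (suc (m * n)) (λ c _ → divisor-as-product c) ⟩
  ∑[ c < suc (m * n) ] ∑[ a < suc m ] ∑[ b < suc n ] (F a b * 𝟙 (a * b ≟ c))
    ≡⟨ ∑-fibres (suc m) (suc n) (suc (m * n)) F (λ a≤m b≤n → s≤s (*-mono-≤ (≤-pred a≤m) (≤-pred b≤n))) ⟨
  ∑[ a < suc m ] ∑[ b < suc n ] F a b
    ≡⟨ ∑-cong (suc m) (λ a _ → ∑-*ˡ (suc n) (𝟙 (a ∣? m)) (λ b → 𝟙 (b ∣? n))) ⟩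
  ∑[ a < suc m ] (𝟙 (a ∣? m) * τ n)
    ≡⟨ ∑-*ʳ (suc m) (τ n) (λ a → 𝟙 (a ∣? m)) ⟩
  τ m * τ n
    ∎
  where
  open ≤-Reasoning
  F : ℕ → ℕ → ℕ
  F a b = 𝟙 (a ∣? m) * 𝟙 (b ∣? n)
  divisor-as-product : ∀ c → 𝟙 (c ∣? m * n) ≤ ∑[ a < suc m ] ∑[ b < suc n ] (F a b * 𝟙 (a * b ≟ c))
  divisor-as-product c with c ∣? m * n
  ... | no  _    = z≤n
  ... | yes c∣mn with ∣m*n⇒∣m*∣n m n c∣mn
  ...   | a , b , a∣m , b∣n , c≡ab = begin
    1
      ≡⟨ cong₂ _*_ (cong₂ _*_ (𝟙-yes (a ∣? m) a∣m) (𝟙-yes (b ∣? n) b∣n)) (𝟙-yes (a * b ≟ c) (sym c≡ab)) ⟨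
    F a b * 𝟙 (a * b ≟ c)
      ≤⟨ term≤∑ (suc n) (λ b → F a b * 𝟙 (a * b ≟ c)) (s≤s (∣⇒≤ b∣n)) ⟩
    ∑[ b < suc n ] (F a b * 𝟙 (a * b ≟ c))
      ≤⟨ term≤∑ (suc m) (λ a → ∑[ b < suc n ] (F a b * 𝟙 (a * b ≟ c))) (s≤s (∣⇒≤ a∣m)) ⟩
    ∑[ a < suc m ] ∑[ b < suc n ] (F a b * 𝟙 (a * b ≟ c))
      ∎

∣p^a⇒≡p^i : ∀ {p} → Prime p → ∀ a {d} → d ∣ p ^ a → ∃ λ i → i ≤ a × d ≡ p ^ i
∣p^a⇒≡p^i p-prime zero    d∣1 = 0 , z≤n , ∣1⇒≡1 d∣1
∣p^a⇒≡p^i {p} p-prime (suc a) {d} d∣p^[1+a] with p ∣? d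
... | yes (divides q refl) with ∣p^a⇒≡p^i p-prime a q∣p^a
  where
  q∣p^a : q ∣ p ^ a
  q∣p^a = *-cancelʳ-∣ p {{prime⇒nonZero p-prime}} (subst (q * p ∣_) (*-comm p (p ^ a)) d∣p^[1+a])
...   | i , i≤a , refl = suc i , s≤s i≤a , *-comm (p ^ i) p
∣p^a⇒≡p^i {p} p-prime (suc a) {d} d∣p^[1+a] | no p∤d with ∣p^a⇒≡p^i p-prime a (coprime-divisor coprime d∣p^[1+a])
  where
  coprime : Coprime d p
  coprime (i∣d , i∣p) with prime⇒irreducible p-prime i∣p
  ... | inj₁ i≡1    = i≡1
  ... | inj₂ refl   = contradiction i∣d p∤d
...   | i , i≤a , d≡p^i = i , m≤n⇒m≤1+n i≤a , d≡p^i

τ[p^a]≤1+a : ∀ {p} → Prime p → ∀ a → τ (p ^ a) ≤ suc a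
τ[p^a]≤1+a {p} p-prime a = begin
  ∑[ d < suc (p ^ a) ] 𝟙 (d ∣? p ^ a)                         ≤⟨ ∑-mono-≤ (suc (p ^ a)) (λ d _ → divisor-is-power d) ⟩
  ∑[ d < suc (p ^ a) ] ∑[ i < suc a ] 𝟙 (d ≟ p ^ i)          ≡⟨ ∑-comm (suc (p ^ a)) (suc a) (λ d i → 𝟙 (d ≟ p ^ i)) ⟩
  ∑[ i < suc a ] ∑[ d < suc (p ^ a) ] 𝟙 (d ≟ p ^ i)          ≤⟨ ∑≤n*c (suc a) (λ i _ → ∑𝟙[≡]≤1 (suc (p ^ a)) (p ^ i)) ⟩
  suc a * 1                                                   ≡⟨ *-identityʳ (suc a) ⟩
  suc a                                                       ∎
  where
  open ≤-Reasoning
  divisor-is-power : ∀ d → 𝟙 (d ∣? p ^ a) ≤ ∑[ i < suc a ] 𝟙 (d ≟ p ^ i)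
  divisor-is-power d with d ∣? p ^ a
  ... | no  _     = z≤n
  ... | yes d∣p^a with ∣p^a⇒≡p^i p-prime a d∣p^a
  ...   | i , i≤a , d≡p^i = ≤-trans (≤-reflexive (sym (𝟙-yes (d ≟ p ^ i) d≡p^i)))
                                      (term≤∑ (suc a) (λ i → 𝟙 (d ≟ p ^ i)) (s≤s i≤a))

split-off-power : ∀ b c → 1 < b → 0 < c → ∃₂ λ a m → c ≡ b ^ a * m × ¬ b ∣ m
split-off-power b = <-rec _ split
  where
  split : ∀ c → (∀ {c′} → c′ < c → 1 < b → 0 < c′ → ∃₂ λ a m → c′ ≡ b ^ a * m × ¬ b ∣ m) →
          1 < b → 0 < c → ∃₂ λ a m → c ≡ b ^ a * m × ¬ b ∣ m
  split c rec 1<b 0<c with b ∣? c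
  ... | no  b∤c = 0 , c , sym (+-identityʳ c) , b∤c
  ... | yes (divides q refl) with rec q<q*b 1<b 0<q
    where
    instance
      q≢0 : NonZero q
      q≢0 = m*n≢0⇒m≢0 q {{>-nonZero 0<c}}
    0<q : 0 < q
    0<q = >-nonZero⁻¹ q
    q<q*b : q < q * b
    q<q*b = m<m*n q b 1<b
  ...   | a , m , refl , b∤m = suc a , m , *-CS.xy∙z≈zx∙y (b ^ a) m b , b∤m

n^n>0 : ∀ n → 0 < n ^ n
n^n>0 zero    = z<s
n^n>0 (suc n) = m^n>0 (suc n) (suc n)

1+n≤2^n : ∀ n → suc n ≤ 2 ^ n
1+n≤2^n zero    = s≤s z≤n
1+n≤2^n (suc n) = subst (_≤ 2 ^ suc n) (+-comm (suc n) 1) (+-mono-≤ (1+n≤2^n n) (≤-trans (m^n>0 2 n) (m≤m+n (2 ^ n) 0)))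

[1+a]^R≤[2^R]^a : ∀ R a → suc a ^ R ≤ (2 ^ R) ^ a
[1+a]^R≤[2^R]^a R a = begin
  suc a ^ R       ≤⟨ ^-monoˡ-≤ R (1+n≤2^n a) ⟩
  (2 ^ a) ^ R     ≡⟨ ^-*-assoc 2 a R ⟩
  2 ^ (a * R)     ≡⟨ cong (2 ^_) (*-comm a R) ⟩
  2 ^ (R * a)     ≡⟨ ^-*-assoc 2 R a ⟨
  (2 ^ R) ^ a     ∎
  where open ≤-Reasoning

[1+a]^R≤R^R*2^a : ∀ R a → suc a ^ R ≤ R ^ R * 2 ^ a
[1+a]^R≤R^R*2^a zero    a = ≤-trans (^-monoʳ-≤ 2 {0} {a} z≤n) (≤-reflexive (sym (+-identityʳ (2 ^ a))))
[1+a]^R≤R^R*2^a R@(suc _) a = begin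
  suc a ^ R                 ≤⟨ ^-monoˡ-≤ R 1+a≤[1+q]*R ⟩
  (suc q * R) ^ R           ≡⟨ ^-distribʳ-* (suc q) R R ⟩
  suc q ^ R * R ^ R         ≤⟨ *-monoˡ-≤ (R ^ R) ([1+a]^R≤[2^R]^a R q) ⟩
  (2 ^ R) ^ q * R ^ R       ≡⟨ cong (_* R ^ R) (trans (^-*-assoc 2 R q) (cong (2 ^_) (*-comm R q))) ⟩
  2 ^ (q * R) * R ^ R       ≤⟨ *-monoˡ-≤ (R ^ R) (^-monoʳ-≤ 2 (m/n*n≤m a R)) ⟩
  2 ^ a * R ^ R             ≡⟨ *-comm (2 ^ a) (R ^ R) ⟩
  R ^ R * 2 ^ a             ∎
  where
  open ≤-Reasoning
  q = a / R
  1+a≤[1+q]*R : suc a ≤ suc q * R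
  1+a≤[1+q]*R = subst (λ x → suc x ≤ suc q * R) (sym (m≡m%n+[m/n]*n a R)) (+-monoˡ-≤ (q * R) (m%n<n a R))

-- Peeling off the prime factors b of c in increasing order, the factor b^a costs
-- (1+a)^R ≤ b^a if b ≥ 2^R and (1+a)^R ≤ R^R·b^a otherwise, i.e. at most 2^R factors R^R in total.
module _ (R : ℕ) where

  private
    M = R ^ R
    B = 2 ^ R
    instance
      M≢0 : NonZero M
      M≢0 = >-nonZero (n^n>0 R)

  prime-power-weight : ∀ {b} a → 2 ≤ b → suc a ^ R * M ^ (B ∸ suc b) ≤ M ^ (B ∸ b) * b ^ a
  prime-power-weight {b} a 2≤b with b <? B
  ... | yes b<B = begin
    suc a ^ R * M ^ (B ∸ suc b)          ≤⟨ *-monoˡ-≤ (M ^ (B ∸ suc b)) ([1+a]^R≤R^R*2^a R a) ⟩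
    M * 2 ^ a * M ^ (B ∸ suc b)          ≤⟨ *-monoˡ-≤ (M ^ (B ∸ suc b)) (*-monoʳ-≤ M (^-monoˡ-≤ a 2≤b)) ⟩
    M * b ^ a * M ^ (B ∸ suc b)          ≡⟨ *-CS.xy∙z≈xz∙y M (b ^ a) (M ^ (B ∸ suc b)) ⟩
    M ^ suc (B ∸ suc b) * b ^ a          ≡⟨ cong (λ x → M ^ x * b ^ a) (+-∸-assoc 1 b<B) ⟨
    M ^ (B ∸ b) * b ^ a                  ∎
    where open ≤-Reasoning
  ... | no  b≮B = begin
    suc a ^ R * M ^ (B ∸ suc b)          ≡⟨ cong (λ x → suc a ^ R * M ^ x) (m≤n⇒m∸n≡0 (≤-trans B≤b (n≤1+n b))) ⟩
    suc a ^ R * 1                        ≡⟨ *-identityʳ (suc a ^ R) ⟩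
    suc a ^ R                            ≤⟨ [1+a]^R≤[2^R]^a R a ⟩
    B ^ a                                ≤⟨ ^-monoˡ-≤ a B≤b ⟩
    b ^ a                                ≡⟨ *-identityˡ (b ^ a) ⟨
    1 * b ^ a                            ≡⟨ cong (λ x → M ^ x * b ^ a) (m≤n⇒m∸n≡0 B≤b) ⟨
    M ^ (B ∸ b) * b ^ a                  ∎
    where
    open ≤-Reasoning
    B≤b : B ≤ b
    B≤b = ≮⇒≥ b≮B

  τ^R≤rough : ∀ k b c → 2 ≤ b → c < b + k → 0 < c → b Rough c → τ c ^ R ≤ M ^ (B ∸ b) * c
  τ^R≤rough zero    b (suc zero)    2≤b c<b _ rough = begin
    τ 1 ^ R             ≡⟨ ^-zeroˡ R ⟩
    1                   ≤⟨ m^n>0 M (B ∸ b) ⟩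
    M ^ (B ∸ b)         ≡⟨ *-identityʳ (M ^ (B ∸ b)) ⟨
    M ^ (B ∸ b) * 1     ∎
    where open ≤-Reasoning
  τ^R≤rough zero    b (2+ c)        2≤b c<b _ rough =
    contradiction (rough⇒≤ rough) (<⇒≱ (subst (2+ c <_) (+-identityʳ b) c<b))
  τ^R≤rough (suc k) b c 2≤b c<b+1+k 0<c rough with b ∣? c
  ... | no  b∤c = begin
    τ c ^ R                  ≤⟨ τ^R≤rough k (suc b) c (m≤n⇒m≤1+n 2≤b) c<1+b+k 0<c (∤⇒rough-suc b∤c rough) ⟩
    M ^ (B ∸ suc b) * c      ≤⟨ *-monoˡ-≤ c (^-monoʳ-≤ M (∸-monoʳ-≤ B (n≤1+n b))) ⟩
    M ^ (B ∸ b) * c          ∎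
    where
    open ≤-Reasoning
    c<1+b+k : c < suc b + k
    c<1+b+k = subst (c <_) (+-suc b k) c<b+1+k
  ... | yes b∣c with split-off-power b c 2≤b 0<c
  ...   | a , m , refl , b∤m = begin
    τ (b ^ a * m) ^ R                            ≤⟨ ^-monoˡ-≤ R (τ-submultiplicative (b ^ a) m) ⟩
    (τ (b ^ a) * τ m) ^ R                        ≤⟨ ^-monoˡ-≤ R (*-monoˡ-≤ (τ m) (τ[p^a]≤1+a b-prime a)) ⟩
    (suc a * τ m) ^ R                            ≡⟨ ^-distribʳ-* (suc a) (τ m) R ⟩
    suc a ^ R * τ m ^ R                          ≤⟨ *-monoʳ-≤ (suc a ^ R) τ[m]^R≤ ⟩
    suc a ^ R * (M ^ (B ∸ suc b) * m)            ≡⟨ *-assoc (suc a ^ R) _ m ⟨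
    suc a ^ R * M ^ (B ∸ suc b) * m              ≤⟨ *-monoˡ-≤ m (prime-power-weight a 2≤b) ⟩
    M ^ (B ∸ b) * b ^ a * m                      ≡⟨ *-assoc (M ^ (B ∸ b)) (b ^ a) m ⟩
    M ^ (B ∸ b) * (b ^ a * m)                    ∎
    where
    open ≤-Reasoning
    instance
      b≢0 : NonZero b
      b≢0 = >-nonZero (<-trans z<s 2≤b)
      b^a≢0 : NonZero (b ^ a)
      b^a≢0 = m^n≢0 b a
      m≢0 : NonZero m
      m≢0 = m*n≢0⇒n≢0 (b ^ a) {{>-nonZero 0<c}}
      b-nontrivial : NonTrivial b
      b-nontrivial = n>1⇒nonTrivial 2≤b
    b-prime : Prime b
    b-prime = rough∧∣⇒prime rough b∣c
    m-rough : suc b Rough m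
    m-rough = ∤⇒rough-suc b∤m (rough∧∣⇒rough rough (n∣m*n (b ^ a)))
    m<1+b+k : m < suc b + k
    m<1+b+k = subst (m <_) (+-suc b k) (≤-<-trans (∣⇒≤ {{>-nonZero 0<c}} (n∣m*n (b ^ a))) c<b+1+k)
    τ[m]^R≤ : τ m ^ R ≤ M ^ (B ∸ suc b) * m
    τ[m]^R≤ = τ^R≤rough k (suc b) m (m≤n⇒m≤1+n 2≤b) m<1+b+k (>-nonZero⁻¹ m) m-rough

  divisor-bound : ∀ c → 0 < c → τ c ^ R ≤ (R ^ R) ^ (2 ^ R) * c
  divisor-bound c 0<c = ≤-trans (τ^R≤rough c 2 c ≤-refl (m≤n⇒m≤1+n (n<1+n c)) 0<c 2-rough)
                                 (*-monoˡ-≤ c (^-monoʳ-≤ M (m∸n≤m B 2)))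

∃-argmax : ∀ (f : ℕ → ℕ) Z → ∃ λ c₀ → c₀ ≤ Z × (∀ c → c ≤ Z → f c ≤ f c₀)
∃-argmax f zero    = 0 , z≤n , λ { zero _ → ≤-refl }
∃-argmax f (suc Z) with ∃-argmax f Z
... | c₀ , c₀≤Z , max₀ with f c₀ ≤? f (suc Z)
...   | yes f[c₀]≤f[1+Z] = suc Z , ≤-refl , max
  where
  max : ∀ c → c ≤ suc Z → f c ≤ f (suc Z)
  max c c≤1+Z with m≤n⇒m<n∨m≡n c≤1+Z
  ... | inj₁ c<1+Z = ≤-trans (max₀ c (≤-pred c<1+Z)) f[c₀]≤f[1+Z]
  ... | inj₂ refl  = ≤-refl
...   | no  f[c₀]≰f[1+Z] = c₀ , m≤n⇒m≤1+n c₀≤Z , max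
  where
  max : ∀ c → c ≤ suc Z → f c ≤ f c₀
  max c c≤1+Z with m≤n⇒m<n∨m≡n c≤1+Z
  ... | inj₁ c<1+Z = max₀ c (≤-pred c<1+Z)
  ... | inj₂ refl  = ≰⇒≥ f[c₀]≰f[1+Z]

τ-max-bound : ∀ R Z → 0 < Z → ∃ λ T → (∀ c → c ≤ Z → τ c ≤ T) × T ^ R ≤ (R ^ R) ^ (2 ^ R) * Z
τ-max-bound R Z 0<Z with ∃-argmax τ Z
... | zero    , _    , τ≤τ[0] = τ 0 , τ≤τ[0] , (begin
  τ 0 ^ R                    ≡⟨ ^-zeroˡ R ⟩
  1                          ≤⟨ m^n>0 ((R ^ R) ^ (2 ^ R)) {{m^n≢0 (R ^ R) (2 ^ R) {{>-nonZero (n^n>0 R)}}}} 1 ⟩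
  (R ^ R) ^ (2 ^ R) * 1      ≤⟨ *-monoʳ-≤ ((R ^ R) ^ (2 ^ R)) 0<Z ⟩
  (R ^ R) ^ (2 ^ R) * Z      ∎)
  where open ≤-Reasoning
... | suc c₀ , c₀<Z , τ≤τ[c₀] = τ (suc c₀) , τ≤τ[c₀] ,
  ≤-trans (divisor-bound R (suc c₀) z<s) (*-monoʳ-≤ ((R ^ R) ^ (2 ^ R)) c₀<Z)

module _ {P : ℕ → Set} (P? : ∀ k → Dec (P k)) (¬P[0] : ¬ P 0) (P-* : ∀ {a b} → P a → P b → P (a * b)) where

  count*count≤ : ∀ H Y T → (∀ c → 0 < c → c ≤ H * Y → τ c ≤ T) → count P? H * count P? Y ≤ T * count P? (H * Y)
  count*count≤ H Y T τ≤T = begin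
    count P? H * count P? Y
      ≡⟨ ∑-*ʳ (suc H) (count P? Y) ρ ⟨
    ∑[ a < suc H ] (ρ a * count P? Y)
      ≡⟨ ∑-cong (suc H) (λ a _ → ∑-*ˡ (suc Y) (ρ a) ρ) ⟨
    ∑[ a < suc H ] ∑[ b < suc Y ] (ρ a * ρ b)
      ≡⟨ ∑-fibres (suc H) (suc Y) (suc (H * Y)) (λ a b → ρ a * ρ b) ab≤HY ⟩
    ∑[ c < suc (H * Y) ] ∑[ a < suc H ] ∑[ b < suc Y ] (ρ a * ρ b * 𝟙 (a * b ≟ c))
      ≤⟨ ∑-mono-≤ (suc (H * Y)) (λ c _ → ∑-mono-≤ (suc H) (λ a _ → ∑-mono-≤ (suc Y) (λ b _ → closed a b c))) ⟩
    ∑[ c < suc (H * Y) ] ∑[ a < suc H ] ∑[ b < suc Y ] (ρ c * 𝟙 (a * b ≟ c))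
      ≡⟨ ∑-cong (suc (H * Y)) (λ c _ → pull-out c) ⟩
    ∑[ c < suc (H * Y) ] (ρ c * fibre c)
      ≤⟨ ∑-mono-≤ (suc (H * Y)) (λ c c≤HY → ρ*fibre≤ c (≤-pred c≤HY)) ⟩
    ∑[ c < suc (H * Y) ] (T * ρ c)
      ≡⟨ ∑-*ˡ (suc (H * Y)) T ρ ⟩
    T * count P? (H * Y)
      ∎
    where
    open ≤-Reasoning
    ρ : ℕ → ℕ
    ρ k = 𝟙 (P? k)
    fibre : ℕ → ℕ
    fibre c = ∑[ a < suc H ] ∑[ b < suc Y ] 𝟙 (a * b ≟ c)
    ab≤HY : ∀ {a b} → a < suc H → b < suc Y → a * b < suc (H * Y)
    ab≤HY a≤H b≤Y = s≤s (*-mono-≤ (≤-pred a≤H) (≤-pred b≤Y))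
    closed : ∀ a b c → ρ a * ρ b * 𝟙 (a * b ≟ c) ≤ ρ c * 𝟙 (a * b ≟ c)
    closed a b c with a * b ≟ c
    ... | no  _    = ≤-reflexive (trans (*-zeroʳ (ρ a * ρ b)) (sym (*-zeroʳ (ρ c))))
    ... | yes refl = *-monoˡ-≤ 1 (𝟙*𝟙≤𝟙 (P? a) (P? b) (P? (a * b)) P-*)
    pull-out : ∀ c → ∑[ a < suc H ] ∑[ b < suc Y ] (ρ c * 𝟙 (a * b ≟ c)) ≡ ρ c * fibre c
    pull-out c = trans (∑-cong (suc H) (λ a _ → ∑-*ˡ (suc Y) (ρ c) (λ b → 𝟙 (a * b ≟ c))))
                       (∑-*ˡ (suc H) (ρ c) (λ a → ∑[ b < suc Y ] 𝟙 (a * b ≟ c)))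
    ρ*fibre≤ : ∀ c → c ≤ H * Y → ρ c * fibre c ≤ T * ρ c
    ρ*fibre≤ zero    _    rewrite 𝟙-no (P? 0) ¬P[0] | *-zeroʳ T = z≤n
    ρ*fibre≤ (suc c) c≤HY = begin
      ρ (suc c) * fibre (suc c)    ≤⟨ *-monoʳ-≤ (ρ (suc c)) (∑∑𝟙[a*b≡c]≤τ (suc H) (suc Y) (suc c)) ⟩
      ρ (suc c) * τ (suc c)        ≤⟨ *-monoʳ-≤ (ρ (suc c)) (τ≤T (suc c) z<s c≤HY) ⟩
      ρ (suc c) * T                ≡⟨ *-comm (ρ (suc c)) T ⟩
      T * ρ (suc c)                ∎

  count^≤ : ∀ H T → 0 < H → ∀ j → (∀ c → 0 < c → c ≤ H ^ suc j → τ c ≤ T) →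
            count P? H ^ suc j ≤ T ^ j * count P? (H ^ suc j)
  count^≤ H T 0<H zero    τ≤T rewrite *-identityʳ H = ≤-reflexive (trans (*-identityʳ (count P? H)) (sym (*-identityˡ (count P? H))))
  count^≤ H T 0<H (suc j) τ≤T = begin
    count P? H * count P? H ^ suc j                       ≤⟨ *-monoʳ-≤ (count P? H) (count^≤ H T 0<H j (λ c 0<c c≤ → τ≤T c 0<c (≤-trans c≤ H^[1+j]≤H^[2+j]))) ⟩
    count P? H * (T ^ j * count P? (H ^ suc j))           ≡⟨ *-CS.x∙yz≈y∙xz (count P? H) (T ^ j) _ ⟩
    T ^ j * (count P? H * count P? (H ^ suc j))           ≤⟨ *-monoʳ-≤ (T ^ j) (count*count≤ H (H ^ suc j) T τ≤T) ⟩
    T ^ j * (T * count P? (H ^ suc (suc j)))              ≡⟨ *-CS.x∙yz≈yx∙z (T ^ j) T _ ⟩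
    T ^ suc j * count P? (H ^ suc (suc j))                ∎
    where
    open ≤-Reasoning
    H^[1+j]≤H^[2+j] : H ^ suc j ≤ H ^ suc (suc j)
    H^[1+j]≤H^[2+j] = ^-monoʳ-≤ H {{>-nonZero 0<H}} (n≤1+n (suc j))

[x+y]^m≤2^m*[x^m+y^m] : ∀ x y m → (x + y) ^ m ≤ 2 ^ m * (x ^ m + y ^ m)
[x+y]^m≤2^m*[x^m+y^m] x y m = begin
  (x + y) ^ m                  ≤⟨ ^-monoˡ-≤ m (+-mono-≤ (m≤m⊔n x y) (≤-trans (m≤n⊔m x y) (m≤m+n (x ⊔ y) 0))) ⟩
  (2 * (x ⊔ y)) ^ m            ≡⟨ ^-distribʳ-* 2 (x ⊔ y) m ⟩
  2 ^ m * (x ⊔ y) ^ m          ≤⟨ *-monoʳ-≤ (2 ^ m) [x⊔y]^m≤ ⟩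
  2 ^ m * (x ^ m + y ^ m)      ∎
  where
  open ≤-Reasoning
  [x⊔y]^m≤ : (x ⊔ y) ^ m ≤ x ^ m + y ^ m
  [x⊔y]^m≤ with ⊔-sel x y
  ... | inj₁ x⊔y≡x = subst (λ z → z ^ m ≤ x ^ m + y ^ m) (sym x⊔y≡x) (m≤m+n (x ^ m) (y ^ m))
  ... | inj₂ x⊔y≡y = subst (λ z → z ^ m ≤ x ^ m + y ^ m) (sym x⊔y≡y) (m≤n+m (y ^ m) (x ^ m))

m*m≤n*n⇒m≤n : ∀ {m n} → m * m ≤ n * n → m ≤ n
m*m≤n*n⇒m≤n {m} {n} m*m≤n*n with m ≤? n
... | yes m≤n = m≤n
... | no  m≰n = contradiction m*m≤n*n (<⇒≱ (*-mono-< (≰⇒> m≰n) (≰⇒> m≰n)))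

A^[nm]*d^m≤[H^[nm]+p^m]*p^n : ∀ {A d T H K} p .{{_ : NonZero p}} n′ m →
  A ^ suc n′ * d ≤ T ^ n′ * (H ^ suc n′ + p) → T ^ (n′ * m + n′ * m) ≤ K * H ^ suc n′ → H < p → K * 4 ^ m ≤ p →
  A ^ (suc n′ * m) * d ^ m ≤ (H ^ (suc n′ * m) + p ^ m) * p ^ suc n′
A^[nm]*d^m≤[H^[nm]+p^m]*p^n {A} {d} {T} {H} {K} p n′ m A^n*d≤ T^R≤K*H^n H<p K*4^m≤p = begin
  A ^ (n * m) * d ^ m                         ≡⟨ cong (_* d ^ m) (^-*-assoc A n m) ⟨
  (A ^ n) ^ m * d ^ m                         ≡⟨ ^-distribʳ-* (A ^ n) d m ⟨
  (A ^ n * d) ^ m                             ≤⟨ ^-monoˡ-≤ m A^n*d≤ ⟩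
  (T ^ n′ * (X + p)) ^ m                      ≡⟨ ^-distribʳ-* (T ^ n′) (X + p) m ⟩
  (T ^ n′) ^ m * (X + p) ^ m                  ≤⟨ *-monoʳ-≤ ((T ^ n′) ^ m) ([x+y]^m≤2^m*[x^m+y^m] X p m) ⟩
  (T ^ n′) ^ m * (2 ^ m * (X ^ m + p ^ m))    ≡⟨ *-assoc ((T ^ n′) ^ m) (2 ^ m) (X ^ m + p ^ m) ⟨
  W * (X ^ m + p ^ m)                         ≤⟨ *-monoˡ-≤ (X ^ m + p ^ m) W≤p^n ⟩
  p ^ n * (X ^ m + p ^ m)                     ≡⟨ cong (λ Y → p ^ n * (Y + p ^ m)) (^-*-assoc H n m) ⟩
  p ^ n * (H ^ (n * m) + p ^ m)               ≡⟨ *-comm (p ^ n) (H ^ (n * m) + p ^ m) ⟩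
  (H ^ (n * m) + p ^ m) * p ^ n               ∎
  where
  open ≤-Reasoning
  n = suc n′
  X = H ^ n
  W = (T ^ n′) ^ m * 2 ^ m
  W≤p^n : W ≤ p ^ n
  W≤p^n = m*m≤n*n⇒m≤n (begin
    W * W                                          ≡⟨ *-CS.interchange ((T ^ n′) ^ m) (2 ^ m) _ _ ⟩
    (T ^ n′) ^ m * (T ^ n′) ^ m * (2 ^ m * 2 ^ m)  ≡⟨ cong₂ _*_ T-part (^-distribʳ-* 2 2 m) ⟨
    T ^ (n′ * m + n′ * m) * 4 ^ m                  ≤⟨ *-monoˡ-≤ (4 ^ m) T^R≤K*H^n ⟩
    K * X * 4 ^ m                                  ≤⟨ *-monoˡ-≤ (4 ^ m) (*-monoʳ-≤ K (^-monoˡ-≤ n (<⇒≤ H<p))) ⟩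
    K * p ^ n * 4 ^ m                              ≡⟨ *-CS.xy∙z≈xz∙y K (p ^ n) (4 ^ m) ⟩
    K * 4 ^ m * p ^ n                              ≤⟨ *-monoˡ-≤ (p ^ n) (≤-trans K*4^m≤p (m≤m*n p (p ^ n′) {{m^n≢0 p n′}})) ⟩
    p ^ n * p ^ n                                  ∎)
    where
    T-part : T ^ (n′ * m + n′ * m) ≡ (T ^ n′) ^ m * (T ^ n′) ^ m
    T-part = trans (^-distribˡ-+-* T (n′ * m) (n′ * m)) (sym (cong₂ _*_ (^-*-assoc T n′ m) (^-*-assoc T n′ m)))

countResidues^n*d≤ : ∀ {n₀ d e H T} j → Prime (suc n₀) → n₀ ≡ e * d → 0 < H →
  (∀ c → 0 < c → c ≤ H ^ suc j → τ c ≤ T) →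
  countResidues (suc n₀) d H ^ suc j * d ≤ T ^ j * (H ^ suc j + suc n₀)
countResidues^n*d≤ {n₀} {d} {e} {H} {T} j p-prime n₀≡e*d 0<H τ≤T = begin
  countResidues p d H ^ suc j * d              ≡⟨ cong (λ I → I ^ suc j * d) (length-filter≡count residue? ¬residue[0] H) ⟩
  count residue? H ^ suc j * d                 ≤⟨ *-monoˡ-≤ d (count^≤ residue? ¬residue[0] (λ {a} {b} → PowerResidue-* p-prime d {a} {b}) H T 0<H j τ≤T) ⟩
  T ^ j * count residue? (H ^ suc j) * d       ≡⟨ *-assoc (T ^ j) _ d ⟩
  T ^ j * (count residue? (H ^ suc j) * d)     ≤⟨ *-monoʳ-≤ (T ^ j) (count-residues p-prime d {e} n₀≡e*d (H ^ suc j)) ⟩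
  T ^ j * (H ^ suc j + p)                      ∎
  where
  open ≤-Reasoning
  p = suc n₀
  residue? : ∀ h → Dec (PowerResidue p d h)
  residue? h = powerResidue? p d h
  ¬residue[0] : ¬ PowerResidue p d 0
  ¬residue[0] = ¬PowerResidue[0] p-prime d

lemma3p2 : (n : ℕ) → 1 ≤ n → (m : ℕ) → 1 ≤ m →
    Σ ℕ λ P₀ → (p : ℕ) → .{{_ : NonZero p}} → Prime p → P₀ ≤ p →
      (d : ℕ) → 1 ≤ d → d ∣ p ∸ 1 → (H : ℕ) → 1 ≤ H → H < p →
        countResidues p d H ^ (n * m) * d ^ m ≤ (H ^ (n * m) + p ^ m) * p ^ n
lemma3p2 (suc n′) _ m _ = K * 4 ^ m , λ { (suc n₀) p-prime K*4^m≤p d _ (divides e n₀≡e*d) H 0<H H<p →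
  let T , τ≤T , T^R≤K*H^n = τ-max-bound R (H ^ suc n′) (m^n>0 H {{>-nonZero 0<H}} (suc n′))
  in  A^[nm]*d^m≤[H^[nm]+p^m]*p^n {K = K} (suc n₀) n′ m
        (countResidues^n*d≤ {e = e} n′ p-prime n₀≡e*d 0<H (λ c _ → τ≤T c))
        T^R≤K*H^n H<p K*4^m≤p }
  where
  R = n′ * m + n′ * m
  K = (R ^ R) ^ (2 ^ R)
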